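{- For every integer $n\ge0$ with $n\neq1$, the Bernoulli number $B_n$ satisfies $$B_n=\frac{1}{2-2^n}\sum_{K=0}^{\lfloor n/2\rfloor}(-1)^K\sum_{1\le q_1,\ldots,q_K\le\lfloor n/2\rfloor}\frac{1}{(2q_1+1)\cdots(2q_K+1)}\binom{n}{2q_1,\ldots,2q_K}.$$
   Context: Bernoulli numbers are defined by $\frac{z}{e^z-1}=\sum_{q\ge0}\frac{B_q}{q!}z^q$. Notation: $\binom{n}{r_1,\ldots,r_K}:=\frac{n!}{r_1!\cdots r_K!}\delta_{n,r_1+\cdots+r_K}$, so the inner sum runs over compositions of $n$ into even positive parts; the $K=0$ term is $\delta_{n,0}$. -}

module Defs where

open import Data.Nat as ℕ using (ℕ; zero; suc; _!; _≡ᵇ_)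
open import Data.Nat.Properties using (_!≢0; m*n≢0)
open import Data.Nat.Combinatorics using (_C_)
open import Data.Integer using (+_)
open import Data.Rational using (ℚ; 0ℚ; 1ℚ; _+_; _*_; -_; _-_; _/_)
open import Data.List using (List; []; _∷_; [_]; _++_; map; foldr; upTo; zipWith; concatMap; length)
open import Data.Bool using (if_then_else_)

sumℚ : List ℚ → ℚ
sumℚ = foldr _+_ 0ℚ

ℕ→ℚ : ℕ → ℚ
ℕ→ℚ n = (+ n) / 1

-- Bernoulli numbers (convention z/(e^z-1), so B₁ = -1/2), via the
-- recurrence equivalent to the generating function:
--   B₀ = 1,  Σ_{k=0}^{n} C(n+1,k) B_k = 0  for n ≥ 1,
-- i.e. B_n = -(1/(n+1)) Σ_{k<n} C(n+1,k) B_k.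

-- given [B₀,…,B_{n-1}], compute B_n
bernoulliStep : ℕ → List ℚ → ℚ
bernoulliStep zero    _  = 1ℚ
bernoulliStep (suc n) bs =
  - (((+ 1) / suc (suc n)) *
     sumℚ (zipWith (λ k b → ℕ→ℚ (suc (suc n) C k) * b) (upTo (suc n)) bs))

bernoulliUpTo : ℕ → List ℚ
bernoulliUpTo zero    = []
bernoulliUpTo (suc n) = bernoulliUpTo n ++ [ bernoulliStep n (bernoulliUpTo n) ]

bernoulli : ℕ → ℚ
bernoulli n = bernoulliStep n (bernoulliUpTo n)

prodFact : List ℕ → ℕ
prodFact []       = 1
prodFact (r ∷ rs) = r ! ℕ.* prodFact rs

prodFact≢0 : ∀ rs → ℕ.NonZero (prodFact rs)
prodFact≢0 []       = _
prodFact≢0 (r ∷ rs) = m*n≢0 (r !) (prodFact rs) {{r !≢0}} {{prodFact≢0 rs}}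

multinomial : ℕ → List ℕ → ℚ
multinomial n rs =
  if n ≡ᵇ foldr ℕ._+_ 0 rs
  then ((+ (n !)) / prodFact rs) {{prodFact≢0 rs}}
  else 0ℚ

tuples : ℕ → ℕ → List (List ℕ)
tuples m zero    = [ [] ]
tuples m (suc K) = concatMap (λ q → map (q ∷_) (tuples m K)) (map suc (upTo m))

prodOdd : List ℕ → ℕ
prodOdd []       = 1
prodOdd (q ∷ qs) = suc (2 ℕ.* q) ℕ.* prodOdd qs

prodOdd≢0 : ∀ qs → ℕ.NonZero (prodOdd qs)
prodOdd≢0 []       = _
prodOdd≢0 (q ∷ qs) = m*n≢0 (suc (2 ℕ.* q)) (prodOdd qs) {{_}} {{prodOdd≢0 qs}}

negOnePow : ℕ → ℚ
negOnePow zero    = 1ℚ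
negOnePow (suc K) = - negOnePow K

rhsSum : ℕ → ℚ
rhsSum n = sumℚ (map (λ K → negOnePow K *
                   sumℚ (map (λ qs → ((+ 1) / prodOdd qs) {{prodOdd≢0 qs}}
                                      * multinomial n (map (2 ℕ.*_) qs))
                             (tuples (n ℕ./ 2) K)))
                 (upTo (suc (n ℕ./ 2))))

denom : ℕ → ℚ
denom n = ℕ→ℚ 2 - ℕ→ℚ (2 ℕ.^ n)

{-# OPTIONS --safe #-}
module Submission where

-- Sequences are multiplied by the binomial convolution, i.e. read as exponential
-- generating functions.  With B(z) = z/(eᶻ - 1), the numbers (2 - 2ⁿ) Bₙ have
-- generating function 2B(z) - B(2z) = z / sinh z, the reciprocal of
-- S(z) = sinh z / z = 1 + T(z), where T has coefficient 1/(2q+1) in each degree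
-- 2q ≥ 2.  The inner sum over (q₁,…,q_K) is the coefficient of zⁿ in Tᴷ, which
-- vanishes below degree 2K, so the right-hand side is the coefficient of zⁿ in
-- Σ_K (-1)ᴷ Tᴷ = 1/S.  Both sequences are inverse to S, hence equal.

open import Defs
open import Data.Nat using (ℕ)
open import Data.Rational using (NonZero; _*_; 1/_)
open import Relation.Binary.PropositionalEquality using (_≡_; _≢_)

open import Data.Nat as ℕ using (zero; suc; _!; _≡ᵇ_; _∸_; _≤_; _<_; z≤n; s≤s; _^_)
import Data.Nat.Properties as ℕ
import Data.Nat.Combinatorics as ℕ
open import Data.Nat.Combinatorics using (_C_)
import Data.Nat.DivMod as ℕ
import Data.Integer as ℤ
import Data.Integer.Properties as ℤ
open import Data.Integer.Tactic.RingSolver using (solve-∀)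
open import Data.Rational using (ℚ; 0ℚ; 1ℚ; _+_; -_; _-_; _/_; toℚᵘ)
import Data.Rational.Properties as ℚ
open import Data.Rational.Unnormalised as ℚᵘ using (ℚᵘ; mkℚᵘ; *≡*; _≃_)
import Data.Rational.Unnormalised.Properties as ℚᵘ
open import Algebra.Properties.Group ℚ.+-0-group using () renaming (⁻¹-involutive to neg-involutive)
open import Data.Rational.Solver using (module +-*-Solver)
open +-*-Solver using (solve; _:+_; _:*_; _:-_; :-_; _:=_)
open import Data.List using (List; []; _∷_; [_]; _++_; map; upTo; applyUpTo; zipWith; concatMap)
open import Data.Nat.ListAction using (sum)
import Data.List.Properties as List
open import Data.Bool using (true; false; T)
open import Data.Empty using (⊥-elim)
open import Data.Product using (Σ; _,_)
open import Data.Sum using (_⊎_; inj₁; inj₂)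
open import Relation.Nullary using (yes; no)
open import Relation.Binary.PropositionalEquality
  using (refl; sym; trans; cong; cong₂; subst; module ≡-Reasoning)

open ≡-Reasoning

-- Arithmetic of ℕ→ℚ and of fractions, checked on unnormalised representatives

toℚᵘ-/ : ∀ i n → toℚᵘ (i / suc n) ≃ mkℚᵘ i n
toℚᵘ-/ i n = ℚ.toℚᵘ-fromℚᵘ (mkℚᵘ i n)

≡-via-ℚᵘ : ∀ {p q : ℚ} (x y : ℚᵘ) → toℚᵘ p ≃ x → toℚᵘ q ≃ y → x ≃ y → p ≡ q
≡-via-ℚᵘ x y p≃x q≃y x≃y =
  ℚ.toℚᵘ-injective (ℚᵘ.≃-trans p≃x (ℚᵘ.≃-trans x≃y (ℚᵘ.≃-sym q≃y)))

ℕ→ℚ-+ : ∀ a b → ℕ→ℚ (a ℕ.+ b) ≡ ℕ→ℚ a + ℕ→ℚ b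
ℕ→ℚ-+ a b = ≡-via-ℚᵘ (mkℚᵘ (ℤ.+ (a ℕ.+ b)) 0) (mkℚᵘ (ℤ.+ a) 0 ℚᵘ.+ mkℚᵘ (ℤ.+ b) 0)
  (toℚᵘ-/ _ 0)
  (ℚᵘ.≃-trans (ℚ.toℚᵘ-homo-+ (ℕ→ℚ a) (ℕ→ℚ b))
               (ℚᵘ.+-cong (toℚᵘ-/ (ℤ.+ a) 0) (toℚᵘ-/ (ℤ.+ b) 0)))
  (*≡* (trans (cong (ℤ._* ℤ.+ 1) (ℤ.pos-+ a b)) (identity (ℤ.+ a) (ℤ.+ b))))
  where
  identity : ∀ x y → (x ℤ.+ y) ℤ.* ℤ.+ 1 ≡ (x ℤ.* ℤ.+ 1 ℤ.+ y ℤ.* ℤ.+ 1) ℤ.* ℤ.+ 1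
  identity = solve-∀

ℕ→ℚ-* : ∀ a b → ℕ→ℚ (a ℕ.* b) ≡ ℕ→ℚ a * ℕ→ℚ b
ℕ→ℚ-* a b = ≡-via-ℚᵘ (mkℚᵘ (ℤ.+ (a ℕ.* b)) 0) (mkℚᵘ (ℤ.+ a) 0 ℚᵘ.* mkℚᵘ (ℤ.+ b) 0)
  (toℚᵘ-/ _ 0)
  (ℚᵘ.≃-trans (ℚ.toℚᵘ-homo-* (ℕ→ℚ a) (ℕ→ℚ b))
               (ℚᵘ.*-cong (toℚᵘ-/ (ℤ.+ a) 0) (toℚᵘ-/ (ℤ.+ b) 0)))
  (*≡* (cong (ℤ._* ℤ.+ 1) (ℤ.pos-* a b)))

ℕ→ℚ-suc : ∀ n → ℕ→ℚ (suc n) ≡ 1ℚ + ℕ→ℚ n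
ℕ→ℚ-suc = ℕ→ℚ-+ 1

/-as-* : ∀ a b .{{_ : ℕ.NonZero b}} → (ℤ.+ a) / b ≡ ℕ→ℚ a * ((ℤ.+ 1) / b)
/-as-* a (suc b) = ≡-via-ℚᵘ (mkℚᵘ (ℤ.+ a) b) (mkℚᵘ (ℤ.+ a) 0 ℚᵘ.* mkℚᵘ (ℤ.+ 1) b)
  (toℚᵘ-/ _ b)
  (ℚᵘ.≃-trans (ℚ.toℚᵘ-homo-* (ℕ→ℚ a) _) (ℚᵘ.*-cong (toℚᵘ-/ (ℤ.+ a) 0) (toℚᵘ-/ (ℤ.+ 1) b)))
  (*≡* (cong₂ ℤ._*_ (sym (ℤ.*-identityʳ (ℤ.+ a))) (cong ℤ.+_ (ℕ.+-identityʳ (suc b)))))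

1/-* : ∀ b c .{{_ : ℕ.NonZero b}} .{{_ : ℕ.NonZero c}} →
  ((ℤ.+ 1) / (b ℕ.* c)) {{ℕ.m*n≢0 b c}} ≡ ((ℤ.+ 1) / b) * ((ℤ.+ 1) / c)
1/-* (suc b) (suc c) =
  ≡-via-ℚᵘ (mkℚᵘ (ℤ.+ 1) (c ℕ.+ b ℕ.* suc c)) (mkℚᵘ (ℤ.+ 1) b ℚᵘ.* mkℚᵘ (ℤ.+ 1) c)
  (toℚᵘ-/ _ _)
  (ℚᵘ.≃-trans (ℚ.toℚᵘ-homo-* ((ℤ.+ 1) / suc b) _) (ℚᵘ.*-cong (toℚᵘ-/ (ℤ.+ 1) b) (toℚᵘ-/ (ℤ.+ 1) c)))
  (*≡* refl)

ℕ→ℚ-*-1/ : ∀ b .{{_ : ℕ.NonZero b}} → ℕ→ℚ b * ((ℤ.+ 1) / b) ≡ 1ℚ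
ℕ→ℚ-*-1/ (suc b) = ≡-via-ℚᵘ (mkℚᵘ (ℤ.+ suc b) 0 ℚᵘ.* mkℚᵘ (ℤ.+ 1) b) (mkℚᵘ (ℤ.+ 1) 0)
  (ℚᵘ.≃-trans (ℚ.toℚᵘ-homo-* (ℕ→ℚ (suc b)) _)
               (ℚᵘ.*-cong (toℚᵘ-/ (ℤ.+ suc b) 0) (toℚᵘ-/ (ℤ.+ 1) b)))
  ℚᵘ.≃-refl
  (*≡* (cong (λ m → ℤ.+ suc m) (trans (ℕ.*-identityʳ (b ℕ.* 1))
    (trans (ℕ.*-identityʳ b) (sym (trans (ℕ.+-identityʳ (b ℕ.+ 0)) (ℕ.+-identityʳ b)))))))

ℕ→ℚ-suc-*-cancelˡ : ∀ n {x y} → ℕ→ℚ (suc n) * x ≡ ℕ→ℚ (suc n) * y → x ≡ y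
ℕ→ℚ-suc-*-cancelˡ n {x} {y} eq = begin
  x                 ≡⟨ cancel x ⟨
  r * (ℕ→ℚ (suc n) * x) ≡⟨ cong (r *_) eq ⟩
  r * (ℕ→ℚ (suc n) * y) ≡⟨ cancel y ⟩
  y                 ∎
  where
  r = (ℤ.+ 1) / suc n
  cancel : ∀ z → r * (ℕ→ℚ (suc n) * z) ≡ z
  cancel z = begin
    r * (ℕ→ℚ (suc n) * z) ≡⟨ ℚ.*-assoc r _ z ⟨
    (r * ℕ→ℚ (suc n)) * z ≡⟨ cong (_* z) (trans (ℚ.*-comm r _) (ℕ→ℚ-*-1/ (suc n))) ⟩
    1ℚ * z               ≡⟨ ℚ.*-identityˡ z ⟩
    z                    ∎

Seq : Set
Seq = ℕ → ℚ

infix  4 _≈_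
infixl 6 _⊕_ _⊝_
infixl 7 _⋆_
infixr 8 _·_

_≈_ : Seq → Seq → Set
f ≈ g = ∀ n → f n ≡ g n

_⊕_ _⊝_ _⋆_ : Seq → Seq → Seq
(f ⊕ g) n = f n + g n
(f ⊝ g) n = f n - g n

neg : Seq → Seq
neg f n = - f n

_·_ : ℚ → Seq → Seq
(c · f) n = c * f n

0ₛ : Seq
0ₛ _ = 0ℚ

∂ : Seq → Seq
∂ f n = f (suc n)

-- The Leibniz rule ∂(f ⋆ g) = ∂f ⋆ g + f ⋆ ∂g determines the binomial convolution
-- (f ⋆ g)ₙ = Σₖ C(n,k) fₖ gₙ₋ₖ, the product of exponential generating functions.
(f ⋆ g) zero    = f 0 * g 0
(f ⋆ g) (suc n) = (∂ f ⋆ g) n + (f ⋆ ∂ g) n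

⋆-cong-≤ : ∀ n {f f′ g g′} → (∀ k → k ≤ n → f k ≡ f′ k) → (∀ k → k ≤ n → g k ≡ g′ k) →
  (f ⋆ g) n ≡ (f′ ⋆ g′) n
⋆-cong-≤ zero    f≡ g≡ = cong₂ _*_ (f≡ 0 z≤n) (g≡ 0 z≤n)
⋆-cong-≤ (suc n) f≡ g≡ = cong₂ _+_
  (⋆-cong-≤ n (λ k k≤n → f≡ (suc k) (s≤s k≤n)) (λ k k≤n → g≡ k (ℕ.m≤n⇒m≤1+n k≤n)))
  (⋆-cong-≤ n (λ k k≤n → f≡ k (ℕ.m≤n⇒m≤1+n k≤n)) (λ k k≤n → g≡ (suc k) (s≤s k≤n)))

⋆-cong : ∀ {f f′ g g′} → f ≈ f′ → g ≈ g′ → f ⋆ g ≈ f′ ⋆ g′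
⋆-cong f≈ g≈ n = ⋆-cong-≤ n (λ k _ → f≈ k) (λ k _ → g≈ k)

⋆-congˡ : ∀ {f g g′} → g ≈ g′ → f ⋆ g ≈ f ⋆ g′
⋆-congˡ = ⋆-cong (λ _ → refl)

⋆-congʳ : ∀ {f f′ g} → f ≈ f′ → f ⋆ g ≈ f′ ⋆ g
⋆-congʳ f≈ = ⋆-cong f≈ (λ _ → refl)

⋆-comm : ∀ f g → f ⋆ g ≈ g ⋆ f
⋆-comm f g zero    = ℚ.*-comm (f 0) (g 0)
⋆-comm f g (suc n) = trans (cong₂ _+_ (⋆-comm (∂ f) g n) (⋆-comm f (∂ g) n))
  (ℚ.+-comm ((g ⋆ ∂ f) n) ((∂ g ⋆ f) n))

⋆-zeroˡ : ∀ g → 0ₛ ⋆ g ≈ 0ₛ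
⋆-zeroˡ g zero    = ℚ.*-zeroˡ (g 0)
⋆-zeroˡ g (suc n) = trans (cong₂ _+_ (⋆-zeroˡ g n) (⋆-zeroˡ (∂ g) n)) (ℚ.+-identityˡ 0ℚ)

⋆-distribʳ-⊕ : ∀ f g h → (f ⊕ g) ⋆ h ≈ f ⋆ h ⊕ g ⋆ h
⋆-distribʳ-⊕ f g h zero    = ℚ.*-distribʳ-+ (h 0) (f 0) (g 0)
⋆-distribʳ-⊕ f g h (suc n) =
  trans (cong₂ _+_ (⋆-distribʳ-⊕ (∂ f) (∂ g) h n) (⋆-distribʳ-⊕ f g (∂ h) n))
        (+-interchange ((∂ f ⋆ h) n) ((∂ g ⋆ h) n) ((f ⋆ ∂ h) n) ((g ⋆ ∂ h) n))
  where
  +-interchange : ∀ a b c d → (a + b) + (c + d) ≡ (a + c) + (b + d)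
  +-interchange = solve 4 (λ a b c d → (a :+ b) :+ (c :+ d) := (a :+ c) :+ (b :+ d)) refl

⋆-distribˡ-⊕ : ∀ f g h → f ⋆ (g ⊕ h) ≈ f ⋆ g ⊕ f ⋆ h
⋆-distribˡ-⊕ f g h n = trans (⋆-comm f (g ⊕ h) n)
  (trans (⋆-distribʳ-⊕ g h f n) (cong₂ _+_ (⋆-comm g f n) (⋆-comm h f n)))

·-⋆ : ∀ c f g → c · f ⋆ g ≈ c · (f ⋆ g)
·-⋆ c f g zero    = ℚ.*-assoc c (f 0) (g 0)
·-⋆ c f g (suc n) = trans (cong₂ _+_ (·-⋆ c (∂ f) g n) (·-⋆ c f (∂ g) n))
  (sym (ℚ.*-distribˡ-+ c ((∂ f ⋆ g) n) ((f ⋆ ∂ g) n)))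

⋆-· : ∀ c f g → f ⋆ c · g ≈ c · (f ⋆ g)
⋆-· c f g n = trans (⋆-comm f (c · g) n) (trans (·-⋆ c g f n) (cong (c *_) (⋆-comm g f n)))

neg-distribˡ-⋆ : ∀ f g → neg f ⋆ g ≈ neg (f ⋆ g)
neg-distribˡ-⋆ f g zero    = sym (ℚ.neg-distribˡ-* (f 0) (g 0))
neg-distribˡ-⋆ f g (suc n) =
  trans (cong₂ _+_ (neg-distribˡ-⋆ (∂ f) g n) (neg-distribˡ-⋆ f (∂ g) n))
        (sym (ℚ.neg-distrib-+ ((∂ f ⋆ g) n) ((f ⋆ ∂ g) n)))

⋆-distribʳ-⊝ : ∀ f g h → (f ⊝ g) ⋆ h ≈ f ⋆ h ⊝ g ⋆ h
⋆-distribʳ-⊝ f g h n =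
  trans (⋆-distribʳ-⊕ f (neg g) h n) (cong ((f ⋆ h) n +_) (neg-distribˡ-⋆ g h n))

⋆-assoc : ∀ f g h → (f ⋆ g) ⋆ h ≈ f ⋆ (g ⋆ h)
⋆-assoc f g h zero    = ℚ.*-assoc (f 0) (g 0) (h 0)
⋆-assoc f g h (suc n) = begin
  ((∂ f ⋆ g ⊕ f ⋆ ∂ g) ⋆ h) n + ((f ⋆ g) ⋆ ∂ h) n
    ≡⟨ cong (_+ ((f ⋆ g) ⋆ ∂ h) n) (⋆-distribʳ-⊕ (∂ f ⋆ g) (f ⋆ ∂ g) h n) ⟩
  (((∂ f ⋆ g) ⋆ h) n + ((f ⋆ ∂ g) ⋆ h) n) + ((f ⋆ g) ⋆ ∂ h) n
    ≡⟨ cong₂ _+_ (cong₂ _+_ (⋆-assoc (∂ f) g h n) (⋆-assoc f (∂ g) h n)) (⋆-assoc f g (∂ h) n) ⟩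
  ((∂ f ⋆ (g ⋆ h)) n + (f ⋆ (∂ g ⋆ h)) n) + (f ⋆ (g ⋆ ∂ h)) n
    ≡⟨ ℚ.+-assoc ((∂ f ⋆ (g ⋆ h)) n) _ _ ⟩
  (∂ f ⋆ (g ⋆ h)) n + ((f ⋆ (∂ g ⋆ h)) n + (f ⋆ (g ⋆ ∂ h)) n)
    ≡⟨ cong ((∂ f ⋆ (g ⋆ h)) n +_) (⋆-distribˡ-⊕ f (∂ g ⋆ h) (g ⋆ ∂ h) n) ⟨
  (∂ f ⋆ (g ⋆ h)) n + (f ⋆ (∂ g ⋆ h ⊕ g ⋆ ∂ h)) n ∎

δ : ℕ → Seq
δ zero    zero    = 1ℚ
δ zero    (suc _) = 0ℚ
δ (suc j) zero    = 0ℚ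
δ (suc j) (suc n) = δ j n

δ-< : ∀ {k j} → j < k → δ k j ≡ 0ℚ
δ-< {suc k} {zero}  _         = refl
δ-< {suc k} {suc j} (s≤s j<k) = δ-< j<k

δ-> : ∀ {k j} → k < j → δ k j ≡ 0ℚ
δ-> {zero}  {suc j} _         = refl
δ-> {suc k} {suc j} (s≤s k<j) = δ-> k<j

δ-diagonal : ∀ k → δ k k ≡ 1ℚ
δ-diagonal zero    = refl
δ-diagonal (suc k) = δ-diagonal k

C-suc-*-∸ : ∀ n j (h : Seq) → ℕ→ℚ (n C suc j) * h (suc (n ∸ suc j)) ≡ ℕ→ℚ (n C suc j) * h (n ∸ j)
C-suc-*-∸ n j h with j ℕ.<? n
... | yes j<n = cong (λ m → ℕ→ℚ (n C suc j) * h m) (sym (ℕ.+-∸-assoc 1 j<n))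
... | no  j≮n rewrite ℕ.k>n⇒nCk≡0 (s≤s (ℕ.≮⇒≥ j≮n)) =
  trans (ℚ.*-zeroˡ (h (suc (n ∸ suc j)))) (sym (ℚ.*-zeroˡ (h (n ∸ j))))

δ-⋆ : ∀ j g n → (δ j ⋆ g) n ≡ ℕ→ℚ (n C j) * g (n ∸ j)
δ-⋆ zero    g zero    = refl
δ-⋆ (suc j) g zero    = refl
δ-⋆ zero    g (suc n) =
  trans (cong₂ _+_ (⋆-zeroˡ g n) (δ-⋆ zero (∂ g) n)) (ℚ.+-identityˡ (1ℚ * g (suc n)))
δ-⋆ (suc j) g (suc n) = begin
  (δ j ⋆ g) n + (δ (suc j) ⋆ ∂ g) n
    ≡⟨ cong₂ _+_ (δ-⋆ j g n) (δ-⋆ (suc j) (∂ g) n) ⟩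
  ℕ→ℚ (n C j) * g (n ∸ j) + ℕ→ℚ (n C suc j) * g (suc (n ∸ suc j))
    ≡⟨ cong (ℕ→ℚ (n C j) * g (n ∸ j) +_) (C-suc-*-∸ n j g) ⟩
  ℕ→ℚ (n C j) * g (n ∸ j) + ℕ→ℚ (n C suc j) * g (n ∸ j)
    ≡⟨ ℚ.*-distribʳ-+ (g (n ∸ j)) (ℕ→ℚ (n C j)) (ℕ→ℚ (n C suc j)) ⟨
  (ℕ→ℚ (n C j) + ℕ→ℚ (n C suc j)) * g (n ∸ j)
    ≡⟨ cong (_* g (n ∸ j)) (trans (sym (ℕ→ℚ-+ (n C j) (n C suc j)))
                                  (cong ℕ→ℚ (ℕ.nCk+nC[k+1]≡[n+1]C[k+1] n j))) ⟩
  ℕ→ℚ (suc n C suc j) * g (n ∸ j) ∎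

⋆-identityˡ : ∀ g → δ 0 ⋆ g ≈ g
⋆-identityˡ g n = trans (δ-⋆ 0 g n) (ℚ.*-identityˡ (g n))

⋆-identityʳ : ∀ f → f ⋆ δ 0 ≈ f
⋆-identityʳ f n = trans (⋆-comm f (δ 0) n) (⋆-identityˡ f n)

⋆-inverse-unique : ∀ {s f g} → s ⋆ f ≈ δ 0 → s ⋆ g ≈ δ 0 → f ≈ g
⋆-inverse-unique {s} {f} {g} sf≈1 sg≈1 n = begin
  f n                ≡⟨ ⋆-identityˡ f n ⟨
  (δ 0 ⋆ f) n        ≡⟨ ⋆-congʳ sg≈1 n ⟨
  ((s ⋆ g) ⋆ f) n    ≡⟨ ⋆-congʳ (⋆-comm s g) n ⟩
  ((g ⋆ s) ⋆ f) n    ≡⟨ ⋆-assoc g s f n ⟩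
  (g ⋆ (s ⋆ f)) n    ≡⟨ ⋆-congˡ sf≈1 n ⟩
  (g ⋆ δ 0) n        ≡⟨ ⋆-identityʳ g n ⟩
  g n                ∎

Σ< : ℕ → (ℕ → ℚ) → ℚ
Σ< zero    f = 0ℚ
Σ< (suc n) f = f 0 + Σ< n (λ k → f (suc k))

Σ<-snoc : ∀ n f → Σ< (suc n) f ≡ Σ< n f + f n
Σ<-snoc zero    f = trans (ℚ.+-identityʳ (f 0)) (sym (ℚ.+-identityˡ (f 0)))
Σ<-snoc (suc n) f = trans (cong (f 0 +_) (Σ<-snoc n (λ k → f (suc k))))
  (sym (ℚ.+-assoc (f 0) (Σ< n (λ k → f (suc k))) (f (suc n))))

Σ<-cong : ∀ n {f g} → (∀ k → k < n → f k ≡ g k) → Σ< n f ≡ Σ< n g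
Σ<-cong zero    _  = refl
Σ<-cong (suc n) eq = cong₂ _+_ (eq 0 (s≤s z≤n)) (Σ<-cong n (λ k k<n → eq (suc k) (s≤s k<n)))

Σ<-zero : ∀ n {f} → (∀ k → k < n → f k ≡ 0ℚ) → Σ< n f ≡ 0ℚ
Σ<-zero n eq = trans (Σ<-cong n eq) (Σ<-const0 n)
  where
  Σ<-const0 : ∀ n → Σ< n (λ _ → 0ℚ) ≡ 0ℚ
  Σ<-const0 zero    = refl
  Σ<-const0 (suc n) = trans (ℚ.+-identityˡ _) (Σ<-const0 n)

Σ<-extend : ∀ {a b} f → a ≤ b → (∀ k → a ≤ k → f k ≡ 0ℚ) → Σ< a f ≡ Σ< b f
Σ<-extend {zero}  {b}     f _         eq = sym (Σ<-zero b (λ k _ → eq k z≤n))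
Σ<-extend {suc a} {suc b} f (s≤s a≤b) eq =
  cong (f 0 +_) (Σ<-extend (λ k → f (suc k)) a≤b (λ k a≤k → eq (suc k) (s≤s a≤k)))

sumℚ-map-upTo : ∀ n f → sumℚ (map f (upTo n)) ≡ Σ< n f
sumℚ-map-upTo n f = go n (λ k → k)
  where
  go : ∀ n g → sumℚ (map f (applyUpTo g n)) ≡ Σ< n (λ k → f (g k))
  go zero    g = refl
  go (suc n) g = cong (f (g 0) +_) (go n (λ k → g (suc k)))

sumℚ-++ : ∀ xs ys → sumℚ (xs ++ ys) ≡ sumℚ xs + sumℚ ys
sumℚ-++ []       ys = sym (ℚ.+-identityˡ (sumℚ ys))
sumℚ-++ (x ∷ xs) ys = trans (cong (x +_) (sumℚ-++ xs ys)) (sym (ℚ.+-assoc x (sumℚ xs) (sumℚ ys)))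

sumℚ-concatMap : ∀ {A B : Set} (f : B → ℚ) (g : A → List B) xs →
  sumℚ (map f (concatMap g xs)) ≡ sumℚ (map (λ x → sumℚ (map f (g x))) xs)
sumℚ-concatMap f g []       = refl
sumℚ-concatMap f g (x ∷ xs) = begin
  sumℚ (map f (g x ++ concatMap g xs))           ≡⟨ cong sumℚ (List.map-++ f (g x) (concatMap g xs)) ⟩
  sumℚ (map f (g x) ++ map f (concatMap g xs))   ≡⟨ sumℚ-++ (map f (g x)) _ ⟩
  sumℚ (map f (g x)) + sumℚ (map f (concatMap g xs))
    ≡⟨ cong (sumℚ (map f (g x)) +_) (sumℚ-concatMap f g xs) ⟩
  sumℚ (map f (g x)) + sumℚ (map (λ x → sumℚ (map f (g x))) xs) ∎

⋆-sumˡ : ∀ {A : Set} xs (F : A → Seq) g →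
  (λ m → sumℚ (map (λ x → F x m) xs)) ⋆ g ≈ λ n → sumℚ (map (λ x → (F x ⋆ g) n) xs)
⋆-sumˡ []       F g n = ⋆-zeroˡ g n
⋆-sumˡ (x ∷ xs) F g n = trans (⋆-distribʳ-⊕ (F x) (λ m → sumℚ (map (λ x → F x m) xs)) g n)
  (cong ((F x ⋆ g) n +_) (⋆-sumˡ xs F g n))

⋆-sumʳ : ∀ {A : Set} xs f (G : A → Seq) →
  f ⋆ (λ m → sumℚ (map (λ x → G x m) xs)) ≈ λ n → sumℚ (map (λ x → (f ⋆ G x) n) xs)
⋆-sumʳ xs f G n = trans (⋆-comm f _ n) (trans (⋆-sumˡ xs G f n)
  (cong sumℚ (List.map-cong (λ x → ⋆-comm (G x) f n) xs)))

⋆-Σ<ˡ : ∀ N (F : ℕ → Seq) g → (λ m → Σ< N (λ k → F k m)) ⋆ g ≈ λ n → Σ< N (λ k → (F k ⋆ g) n)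
⋆-Σ<ˡ N F g n = begin
  ((λ m → Σ< N (λ k → F k m)) ⋆ g) n
    ≡⟨ ⋆-congʳ (λ m → sumℚ-map-upTo N (λ k → F k m)) n ⟨
  ((λ m → sumℚ (map (λ k → F k m) (upTo N))) ⋆ g) n
    ≡⟨ ⋆-sumˡ (upTo N) F g n ⟩
  sumℚ (map (λ k → (F k ⋆ g) n) (upTo N))
    ≡⟨ sumℚ-map-upTo N (λ k → (F k ⋆ g) n) ⟩
  Σ< N (λ k → (F k ⋆ g) n) ∎

⋆-Σ<ʳ : ∀ N f (G : ℕ → Seq) → f ⋆ (λ m → Σ< N (λ k → G k m)) ≈ λ n → Σ< N (λ k → (f ⋆ G k) n)
⋆-Σ<ʳ N f G n = trans (⋆-comm f _ n) (trans (⋆-Σ<ˡ N G f n)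
  (Σ<-cong N (λ k _ → ⋆-comm (G k) f n)))

Σ<-*-δ : ∀ N f {m} → m < N → Σ< N (λ k → f k * δ k m) ≡ f m
Σ<-*-δ (suc N) f {zero} _ = begin
  f 0 * 1ℚ + Σ< N (λ k → f (suc k) * 0ℚ)
    ≡⟨ cong₂ _+_ (ℚ.*-identityʳ (f 0)) (Σ<-zero N (λ k _ → ℚ.*-zeroʳ (f (suc k)))) ⟩
  f 0 + 0ℚ ≡⟨ ℚ.+-identityʳ (f 0) ⟩
  f 0      ∎
Σ<-*-δ (suc N) f {suc m} (s≤s m<N) =
  trans (cong₂ _+_ (ℚ.*-zeroʳ (f 0)) (Σ<-*-δ N (λ k → f (suc k)) m<N)) (ℚ.+-identityˡ (f (suc m)))

⋆-binomial : ∀ f g n → (f ⋆ g) n ≡ Σ< (suc n) (λ k → ℕ→ℚ (n C k) * f k * g (n ∸ k))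
⋆-binomial f g n = begin
  (f ⋆ g) n
    ≡⟨ ⋆-cong-≤ n (λ m m≤n → sym (Σ<-*-δ (suc n) f (s≤s m≤n))) (λ _ _ → refl) ⟩
  ((λ m → Σ< (suc n) (λ k → f k * δ k m)) ⋆ g) n
    ≡⟨ ⋆-Σ<ˡ (suc n) (λ k → f k · δ k) g n ⟩
  Σ< (suc n) (λ k → (f k · δ k ⋆ g) n)
    ≡⟨ Σ<-cong (suc n) (λ k _ → trans (·-⋆ (f k) (δ k) g n) (cong (f k *_) (δ-⋆ k g n))) ⟩
  Σ< (suc n) (λ k → f k * (ℕ→ℚ (n C k) * g (n ∸ k)))
    ≡⟨ Σ<-cong (suc n) (λ k _ → *-rearrange (f k) (ℕ→ℚ (n C k)) (g (n ∸ k))) ⟩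
  Σ< (suc n) (λ k → ℕ→ℚ (n C k) * f k * g (n ∸ k)) ∎
  where
  *-rearrange : ∀ a c b → a * (c * b) ≡ c * a * b
  *-rearrange = solve 3 (λ a c b → a :* (c :* b) := c :* a :* b) refl

-- Multiplying the generating function by z, and substituting 2z for z

zMul : Seq → Seq
zMul f zero    = 0ℚ
zMul f (suc n) = ℕ→ℚ (suc n) * f n

∂-zMul : ∀ f → ∂ (zMul f) ≈ f ⊕ zMul (∂ f)
∂-zMul f zero    = trans (ℚ.*-identityˡ (f 0)) (sym (ℚ.+-identityʳ (f 0)))
∂-zMul f (suc k) = begin
  ℕ→ℚ (suc (suc k)) * x          ≡⟨ cong (_* x) (ℕ→ℚ-suc (suc k)) ⟩
  (1ℚ + ℕ→ℚ (suc k)) * x         ≡⟨ ℚ.*-distribʳ-+ x 1ℚ (ℕ→ℚ (suc k)) ⟩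
  1ℚ * x + ℕ→ℚ (suc k) * x       ≡⟨ cong (_+ ℕ→ℚ (suc k) * x) (ℚ.*-identityˡ x) ⟩
  x + ℕ→ℚ (suc k) * x            ∎
  where x = f (suc k)

zMul-∂ : ∀ f n → zMul (∂ f) n ≡ ℕ→ℚ n * f n
zMul-∂ f zero    = sym (ℚ.*-zeroˡ (f 0))
zMul-∂ f (suc n) = refl

zMul-⊕ : ∀ f g → zMul (f ⊕ g) ≈ zMul f ⊕ zMul g
zMul-⊕ f g zero    = sym (ℚ.+-identityˡ 0ℚ)
zMul-⊕ f g (suc n) = ℚ.*-distribˡ-+ (ℕ→ℚ (suc n)) (f n) (g n)

zMul-⋆ : ∀ f g → zMul (f ⋆ g) ≈ zMul f ⋆ g
zMul-⋆ f g zero    = sym (ℚ.*-zeroˡ (g 0))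
zMul-⋆ f g (suc n) = sym (begin
  (∂ (zMul f) ⋆ g) n + (zMul f ⋆ ∂ g) n
    ≡⟨ cong (_+ (zMul f ⋆ ∂ g) n) (⋆-congʳ (∂-zMul f) n) ⟩
  ((f ⊕ zMul (∂ f)) ⋆ g) n + (zMul f ⋆ ∂ g) n
    ≡⟨ cong (_+ (zMul f ⋆ ∂ g) n) (⋆-distribʳ-⊕ f (zMul (∂ f)) g n) ⟩
  ((f ⋆ g) n + (zMul (∂ f) ⋆ g) n) + (zMul f ⋆ ∂ g) n
    ≡⟨ ℚ.+-assoc ((f ⋆ g) n) _ _ ⟩
  (f ⋆ g) n + ((zMul (∂ f) ⋆ g) n + (zMul f ⋆ ∂ g) n)
    ≡⟨ cong ((f ⋆ g) n +_) (cong₂ _+_ (zMul-⋆ (∂ f) g n) (zMul-⋆ f (∂ g) n)) ⟨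
  (f ⋆ g) n + (zMul (∂ f ⋆ g) n + zMul (f ⋆ ∂ g) n)
    ≡⟨ cong ((f ⋆ g) n +_) (trans (sym (zMul-⊕ (∂ f ⋆ g) (f ⋆ ∂ g) n)) (zMul-∂ (f ⋆ g) n)) ⟩
  (f ⋆ g) n + ℕ→ℚ n * (f ⋆ g) n
    ≡⟨ cong (_+ ℕ→ℚ n * (f ⋆ g) n) (ℚ.*-identityˡ ((f ⋆ g) n)) ⟨
  1ℚ * (f ⋆ g) n + ℕ→ℚ n * (f ⋆ g) n
    ≡⟨ ℚ.*-distribʳ-+ ((f ⋆ g) n) 1ℚ (ℕ→ℚ n) ⟨
  (1ℚ + ℕ→ℚ n) * (f ⋆ g) n
    ≡⟨ cong (_* (f ⋆ g) n) (ℕ→ℚ-suc n) ⟨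
  ℕ→ℚ (suc n) * (f ⋆ g) n ∎)

zMul-injective : ∀ {f g} → zMul f ≈ zMul g → f ≈ g
zMul-injective zf≈zg n = ℕ→ℚ-suc-*-cancelˡ n (zf≈zg (suc n))

two : ℚ
two = ℕ→ℚ 2

dilate2 : Seq → Seq
dilate2 f n = ℕ→ℚ (2 ^ n) * f n

∂-dilate2 : ∀ f → ∂ (dilate2 f) ≈ two · dilate2 (∂ f)
∂-dilate2 f n = trans (cong (_* f (suc n)) (ℕ→ℚ-* 2 (2 ^ n))) (ℚ.*-assoc two (ℕ→ℚ (2 ^ n)) (f (suc n)))

dilate2-⋆ : ∀ f g → dilate2 f ⋆ dilate2 g ≈ dilate2 (f ⋆ g)
dilate2-⋆ f g zero    =
  trans (cong₂ _*_ (ℚ.*-identityˡ (f 0)) (ℚ.*-identityˡ (g 0))) (sym (ℚ.*-identityˡ (f 0 * g 0)))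
dilate2-⋆ f g (suc n) = begin
  (∂ (dilate2 f) ⋆ dilate2 g) n + (dilate2 f ⋆ ∂ (dilate2 g)) n
    ≡⟨ cong₂ _+_ (⋆-congʳ (∂-dilate2 f) n) (⋆-congˡ (∂-dilate2 g) n) ⟩
  (two · dilate2 (∂ f) ⋆ dilate2 g) n + (dilate2 f ⋆ two · dilate2 (∂ g)) n
    ≡⟨ cong₂ _+_ (·-⋆ two (dilate2 (∂ f)) (dilate2 g) n) (⋆-· two (dilate2 f) (dilate2 (∂ g)) n) ⟩
  two * (dilate2 (∂ f) ⋆ dilate2 g) n + two * (dilate2 f ⋆ dilate2 (∂ g)) n
    ≡⟨ cong₂ (λ x y → two * x + two * y) (dilate2-⋆ (∂ f) g n) (dilate2-⋆ f (∂ g) n) ⟩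
  two * (ℕ→ℚ (2 ^ n) * (∂ f ⋆ g) n) + two * (ℕ→ℚ (2 ^ n) * (f ⋆ ∂ g) n)
    ≡⟨ factor two (ℕ→ℚ (2 ^ n)) ((∂ f ⋆ g) n) ((f ⋆ ∂ g) n) ⟩
  two * ℕ→ℚ (2 ^ n) * ((∂ f ⋆ g) n + (f ⋆ ∂ g) n)
    ≡⟨ cong (_* ((∂ f ⋆ g) n + (f ⋆ ∂ g) n)) (ℕ→ℚ-* 2 (2 ^ n)) ⟨
  ℕ→ℚ (2 ^ suc n) * ((∂ f ⋆ g) n + (f ⋆ ∂ g) n) ∎
  where
  factor : ∀ t p a b → t * (p * a) + t * (p * b) ≡ t * p * (a + b)
  factor = solve 4 (λ t p a b → t :* (p :* a) :+ t :* (p :* b) := t :* p :* (a :+ b)) refl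

-- The exponentials eᶻ, e⁻ᶻ, eᶻ - 1 and 2 sinh z = eᶻ - e⁻ᶻ

exp expNeg expMinusOne twoSinh : Seq
exp _       = 1ℚ
expNeg      = negOnePow
expMinusOne = exp ⊝ δ 0
twoSinh     = exp ⊝ expNeg

exp⋆exp : ∀ n → (exp ⋆ exp) n ≡ ℕ→ℚ (2 ^ n)
exp⋆exp zero    = refl
exp⋆exp (suc n) = begin
  (exp ⋆ exp) n + (exp ⋆ exp) n ≡⟨ cong₂ _+_ (exp⋆exp n) (exp⋆exp n) ⟩
  ℕ→ℚ (2 ^ n) + ℕ→ℚ (2 ^ n)    ≡⟨ ℕ→ℚ-+ (2 ^ n) (2 ^ n) ⟨
  ℕ→ℚ (2 ^ n ℕ.+ 2 ^ n)        ≡⟨ cong (λ m → ℕ→ℚ (2 ^ n ℕ.+ m)) (ℕ.+-identityʳ (2 ^ n)) ⟨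
  ℕ→ℚ (2 ^ suc n)              ∎

exp⋆expNeg : exp ⋆ expNeg ≈ δ 0
exp⋆expNeg zero    = refl
exp⋆expNeg (suc n) = begin
  (exp ⋆ expNeg) n + (exp ⋆ neg expNeg) n
    ≡⟨ cong ((exp ⋆ expNeg) n +_) (trans (⋆-comm exp (neg expNeg) n)
         (trans (neg-distribˡ-⋆ expNeg exp n) (cong -_ (⋆-comm expNeg exp n)))) ⟩
  (exp ⋆ expNeg) n - (exp ⋆ expNeg) n ≡⟨ ℚ.+-inverseʳ ((exp ⋆ expNeg) n) ⟩
  0ℚ ∎

expMinusOne⋆[1+expNeg] : expMinusOne ⋆ (δ 0 ⊕ expNeg) ≈ twoSinh
expMinusOne⋆[1+expNeg] n = begin
  (expMinusOne ⋆ (δ 0 ⊕ expNeg)) n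
    ≡⟨ ⋆-distribˡ-⊕ expMinusOne (δ 0) expNeg n ⟩
  (expMinusOne ⋆ δ 0) n + (expMinusOne ⋆ expNeg) n
    ≡⟨ cong₂ _+_ (⋆-identityʳ expMinusOne n) (⋆-distribʳ-⊝ exp (δ 0) expNeg n) ⟩
  (1ℚ - δ 0 n) + ((exp ⋆ expNeg) n - (δ 0 ⋆ expNeg) n)
    ≡⟨ cong (λ x → (1ℚ - δ 0 n) + x) (cong₂ _-_ (exp⋆expNeg n) (⋆-identityˡ expNeg n)) ⟩
  (1ℚ - δ 0 n) + (δ 0 n - expNeg n)
    ≡⟨ telescope 1ℚ (δ 0 n) (expNeg n) ⟩
  1ℚ - expNeg n ∎
  where
  telescope : ∀ a x y → (a - x) + (x - y) ≡ a - y
  telescope = solve 3 (λ a x y → (a :- x) :+ (x :- y) := a :- y) refl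

dilate2-expMinusOne⋆expNeg : dilate2 expMinusOne ⋆ expNeg ≈ twoSinh
dilate2-expMinusOne⋆expNeg n = begin
  (dilate2 expMinusOne ⋆ expNeg) n
    ≡⟨ ⋆-congʳ dilate2-expMinusOne n ⟩
  ((exp ⋆ exp ⊝ δ 0) ⋆ expNeg) n
    ≡⟨ ⋆-distribʳ-⊝ (exp ⋆ exp) (δ 0) expNeg n ⟩
  ((exp ⋆ exp) ⋆ expNeg) n - (δ 0 ⋆ expNeg) n
    ≡⟨ cong₂ _-_ (⋆-assoc exp exp expNeg n) (⋆-identityˡ expNeg n) ⟩
  (exp ⋆ (exp ⋆ expNeg)) n - expNeg n
    ≡⟨ cong (_- expNeg n) (trans (⋆-congˡ exp⋆expNeg n) (⋆-identityʳ exp n)) ⟩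
  1ℚ - expNeg n ∎
  where
  dilate2-expMinusOne : dilate2 expMinusOne ≈ exp ⋆ exp ⊝ δ 0
  dilate2-expMinusOne zero    = refl
  dilate2-expMinusOne (suc n) =
    trans (ℚ.*-identityʳ (ℕ→ℚ (2 ^ suc n)))
      (trans (sym (ℚ.+-identityʳ (ℕ→ℚ (2 ^ suc n)))) (cong (_- 0ℚ) (sym (exp⋆exp (suc n)))))

expMinusOne-pos : ∀ {m} → 0 < m → expMinusOne m ≡ 1ℚ
expMinusOne-pos {suc m} _ = refl

bernoulliUpTo≡ : ∀ n → bernoulliUpTo n ≡ map bernoulli (upTo n)
bernoulliUpTo≡ zero    = refl
bernoulliUpTo≡ (suc n) = begin
  bernoulliUpTo n ++ [ bernoulli n ]             ≡⟨ cong (_++ [ bernoulli n ]) (bernoulliUpTo≡ n) ⟩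
  map bernoulli (upTo n) ++ map bernoulli [ n ]  ≡⟨ List.map-++ bernoulli (upTo n) [ n ] ⟨
  map bernoulli (upTo n ++ [ n ])                ≡⟨ cong (map bernoulli) (List.upTo-∷ʳ n) ⟩
  map bernoulli (upTo (suc n))                   ∎

bernoulli-suc : ∀ n → bernoulli (suc n) ≡
  - ((ℤ.+ 1 / suc (suc n)) * Σ< (suc n) (λ k → ℕ→ℚ (suc (suc n) C k) * bernoulli k))
bernoulli-suc n = cong (λ x → - ((ℤ.+ 1 / suc (suc n)) * x)) (begin
  sumℚ (zipWith term (upTo (suc n)) (bernoulliUpTo (suc n)))
    ≡⟨ cong (λ bs → sumℚ (zipWith term (upTo (suc n)) bs)) (bernoulliUpTo≡ (suc n)) ⟩
  sumℚ (zipWith term (upTo (suc n)) (map bernoulli (upTo (suc n))))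
    ≡⟨ cong sumℚ (zipWith-map (upTo (suc n))) ⟩
  sumℚ (map (λ k → term k (bernoulli k)) (upTo (suc n)))
    ≡⟨ sumℚ-map-upTo (suc n) (λ k → term k (bernoulli k)) ⟩
  Σ< (suc n) (λ k → ℕ→ℚ (suc (suc n) C k) * bernoulli k) ∎)
  where
  term : ℕ → ℚ → ℚ
  term k b = ℕ→ℚ (suc (suc n) C k) * b
  zipWith-map : ∀ ks → zipWith term ks (map bernoulli ks) ≡ map (λ k → term k (bernoulli k)) ks
  zipWith-map []       = refl
  zipWith-map (k ∷ ks) = cong (term k (bernoulli k) ∷_) (zipWith-map ks)

bernoulli-recurrence : ∀ n → Σ< (suc (suc n)) (λ k → ℕ→ℚ (suc (suc n) C k) * bernoulli k) ≡ 0ℚ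
bernoulli-recurrence n = begin
  Σ< N (λ k → ℕ→ℚ (N C k) * bernoulli k)
    ≡⟨ Σ<-snoc (suc n) (λ k → ℕ→ℚ (N C k) * bernoulli k) ⟩
  S + ℕ→ℚ (N C suc n) * bernoulli (suc n)
    ≡⟨ cong₂ (λ c b → S + ℕ→ℚ c * b) C[N,N-1]≡N (bernoulli-suc n) ⟩
  S + ℕ→ℚ N * - ((ℤ.+ 1 / N) * S)                   ≡⟨ cancel S (ℕ→ℚ N) (ℤ.+ 1 / N) ⟩
  S - (ℕ→ℚ N * (ℤ.+ 1 / N)) * S                     ≡⟨ cong (λ x → S - x * S) (ℕ→ℚ-*-1/ N) ⟩
  S - 1ℚ * S                                        ≡⟨ cong (λ x → S - x) (ℚ.*-identityˡ S) ⟩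
  S - S                                             ≡⟨ ℚ.+-inverseʳ S ⟩
  0ℚ                                                ∎
  where
  N = suc (suc n)
  S = Σ< (suc n) (λ k → ℕ→ℚ (N C k) * bernoulli k)
  C[N,N-1]≡N : N C suc n ≡ N
  C[N,N-1]≡N = trans (ℕ.nCk≡nC[n∸k] (ℕ.n≤1+n (suc n)))
                     (trans (cong (N C_) (ℕ.m+n∸n≡m 1 (suc n))) (ℕ.nC1≡n N))
  cancel : ∀ S c r → S + c * - (r * S) ≡ S - (c * r) * S
  cancel = solve 3 (λ S c r → S :+ c :* (:- (r :* S)) := S :- (c :* r) :* S) refl

bernoulli⋆expMinusOne : bernoulli ⋆ expMinusOne ≈ δ 1
bernoulli⋆expMinusOne zero          = refl
bernoulli⋆expMinusOne (suc zero)    = refl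
bernoulli⋆expMinusOne (suc (suc n)) = begin
  (bernoulli ⋆ expMinusOne) N                          ≡⟨ ⋆-binomial bernoulli expMinusOne N ⟩
  Σ< (suc N) term                                      ≡⟨ Σ<-snoc N term ⟩
  Σ< N term + term N                                   ≡⟨ cong₂ _+_ (Σ<-cong N last-factor-one) last-term-zero ⟩
  Σ< N (λ k → ℕ→ℚ (N C k) * bernoulli k) + 0ℚ          ≡⟨ ℚ.+-identityʳ _ ⟩
  Σ< N (λ k → ℕ→ℚ (N C k) * bernoulli k)               ≡⟨ bernoulli-recurrence n ⟩
  0ℚ                                                   ∎
  where
  N = suc (suc n)
  term : ℕ → ℚ
  term k = ℕ→ℚ (N C k) * bernoulli k * expMinusOne (N ∸ k)
  last-factor-one : ∀ k → k < N → term k ≡ ℕ→ℚ (N C k) * bernoulli k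
  last-factor-one k k<N = trans (cong (ℕ→ℚ (N C k) * bernoulli k *_) (expMinusOne-pos (ℕ.m<n⇒0<n∸m k<N)))
                                (ℚ.*-identityʳ (ℕ→ℚ (N C k) * bernoulli k))
  last-term-zero : term N ≡ 0ℚ
  last-term-zero = trans (cong (λ m → ℕ→ℚ (N C N) * bernoulli N * expMinusOne m) (ℕ.n∸n≡0 N))
                         (ℚ.*-zeroʳ (ℕ→ℚ (N C N) * bernoulli N))

-- (2 - 2ⁿ) Bₙ are the coefficients of 2B(z) - B(2z) = z / sinh z

scaledBernoulli : Seq
scaledBernoulli n = denom n * bernoulli n

bernoulli⋆twoSinh : bernoulli ⋆ twoSinh ≈ δ 1 ⊕ δ 1 ⋆ expNeg
bernoulli⋆twoSinh n = begin
  (bernoulli ⋆ twoSinh) n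
    ≡⟨ ⋆-congˡ expMinusOne⋆[1+expNeg] n ⟨
  (bernoulli ⋆ (expMinusOne ⋆ (δ 0 ⊕ expNeg))) n
    ≡⟨ ⋆-assoc bernoulli expMinusOne (δ 0 ⊕ expNeg) n ⟨
  ((bernoulli ⋆ expMinusOne) ⋆ (δ 0 ⊕ expNeg)) n
    ≡⟨ ⋆-congʳ bernoulli⋆expMinusOne n ⟩
  (δ 1 ⋆ (δ 0 ⊕ expNeg)) n
    ≡⟨ ⋆-distribˡ-⊕ (δ 1) (δ 0) expNeg n ⟩
  (δ 1 ⋆ δ 0) n + (δ 1 ⋆ expNeg) n
    ≡⟨ cong (_+ (δ 1 ⋆ expNeg) n) (⋆-identityʳ (δ 1) n) ⟩
  δ 1 n + (δ 1 ⋆ expNeg) n ∎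

dilate2-bernoulli⋆twoSinh : dilate2 bernoulli ⋆ twoSinh ≈ two · (δ 1 ⋆ expNeg)
dilate2-bernoulli⋆twoSinh n = begin
  (dilate2 bernoulli ⋆ twoSinh) n
    ≡⟨ ⋆-congˡ dilate2-expMinusOne⋆expNeg n ⟨
  (dilate2 bernoulli ⋆ (dilate2 expMinusOne ⋆ expNeg)) n
    ≡⟨ ⋆-assoc (dilate2 bernoulli) (dilate2 expMinusOne) expNeg n ⟨
  ((dilate2 bernoulli ⋆ dilate2 expMinusOne) ⋆ expNeg) n
    ≡⟨ ⋆-congʳ (dilate2-⋆ bernoulli expMinusOne) n ⟩
  (dilate2 (bernoulli ⋆ expMinusOne) ⋆ expNeg) n
    ≡⟨ ⋆-congʳ (λ m → trans (cong (ℕ→ℚ (2 ^ m) *_) (bernoulli⋆expMinusOne m)) (dilate2-δ1 m)) n ⟩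
  (two · δ 1 ⋆ expNeg) n
    ≡⟨ ·-⋆ two (δ 1) expNeg n ⟩
  two * (δ 1 ⋆ expNeg) n ∎
  where
  dilate2-δ1 : dilate2 (δ 1) ≈ two · δ 1
  dilate2-δ1 zero          = refl
  dilate2-δ1 (suc zero)    = refl
  dilate2-δ1 (suc (suc n)) = trans (ℚ.*-zeroʳ (ℕ→ℚ (2 ^ suc (suc n)))) (sym (ℚ.*-zeroʳ two))

scaledBernoulli⋆twoSinh : scaledBernoulli ⋆ twoSinh ≈ two · δ 1
scaledBernoulli⋆twoSinh n = begin
  (scaledBernoulli ⋆ twoSinh) n
    ≡⟨ ⋆-congʳ (λ m → *-distribʳ-- two (ℕ→ℚ (2 ^ m)) (bernoulli m)) n ⟩
  ((two · bernoulli ⊝ dilate2 bernoulli) ⋆ twoSinh) n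
    ≡⟨ ⋆-distribʳ-⊝ (two · bernoulli) (dilate2 bernoulli) twoSinh n ⟩
  (two · bernoulli ⋆ twoSinh) n - (dilate2 bernoulli ⋆ twoSinh) n
    ≡⟨ cong₂ _-_ (·-⋆ two bernoulli twoSinh n) (dilate2-bernoulli⋆twoSinh n) ⟩
  two * (bernoulli ⋆ twoSinh) n - two * (δ 1 ⋆ expNeg) n
    ≡⟨ cong (λ x → two * x - two * (δ 1 ⋆ expNeg) n) (bernoulli⋆twoSinh n) ⟩
  two * (δ 1 n + (δ 1 ⋆ expNeg) n) - two * (δ 1 ⋆ expNeg) n
    ≡⟨ cancel two (δ 1 n) ((δ 1 ⋆ expNeg) n) ⟩
  two * δ 1 n ∎
  where
  *-distribʳ-- : ∀ x y z → (x - y) * z ≡ x * z - y * z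
  *-distribʳ-- = solve 3 (λ x y z → (x :- y) :* z := x :* z :- y :* z) refl
  cancel : ∀ t x c → t * (x + c) - t * c ≡ t * x
  cancel = solve 3 (λ t x c → t :* (x :+ c) :- t :* c := t :* x) refl

-- S(z) = sinh z / z and its part T of positive degree, truncated at degree 2m

oddRecip : ℕ → ℚ
oddRecip q = ℤ.+ 1 / suc (2 ℕ.* q)

sinhTail : ℕ → Seq
sinhTail m j = Σ< m (λ i → oddRecip (suc i) * δ (2 ℕ.* suc i) j)

-- sinhTail m j no longer depends on m once j < 2m + 2, so its diagonal is the untruncated T.
sinhc : Seq
sinhc j = δ 0 j + sinhTail j j

*-δ-< : ∀ x {k j} → j < k → x * δ k j ≡ 0ℚ
*-δ-< x j<k = trans (cong (x *_) (δ-< j<k)) (ℚ.*-zeroʳ x)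

*-δ-> : ∀ x {k j} → k < j → x * δ k j ≡ 0ℚ
*-δ-> x k<j = trans (cong (x *_) (δ-> k<j)) (ℚ.*-zeroʳ x)

sinhTail-stable : ∀ {m m′ j} → m ≤ m′ → j < 2 ℕ.* suc m → sinhTail m j ≡ sinhTail m′ j
sinhTail-stable {m} {m′} {j} m≤m′ j<2m+2 = Σ<-extend _ m≤m′ λ i m≤i →
  *-δ-< (oddRecip (suc i)) (ℕ.<-≤-trans j<2m+2 (ℕ.*-monoʳ-≤ 2 (s≤s m≤i)))

sinhTail-> : ∀ m {j} → 2 ℕ.* m < j → sinhTail m j ≡ 0ℚ
sinhTail-> m 2m<j = Σ<-zero m λ i i<m →
  *-δ-> (oddRecip (suc i)) (ℕ.≤-<-trans (ℕ.*-monoʳ-≤ 2 i<m) 2m<j)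

sinhTail-vanishesBelow2 : ∀ m {j} → j < 2 → sinhTail m j ≡ 0ℚ
sinhTail-vanishesBelow2 m j<2 = Σ<-zero m λ i _ →
  *-δ-< (oddRecip (suc i)) (ℕ.<-≤-trans j<2 (ℕ.*-monoʳ-≤ 2 (s≤s z≤n)))

sinhc-stable : ∀ M {j} → j < 2 ℕ.* suc M → sinhc j ≡ δ 0 j + sinhTail M j
sinhc-stable M {j} j<2M+2 with j ℕ.≤? M
... | yes j≤M = cong (δ 0 j +_) (sinhTail-stable j≤M (ℕ.<-≤-trans (ℕ.n<1+n j) (ℕ.m≤n*m (suc j) 2)))
... | no  j≰M = cong (δ 0 j +_) (sym (sinhTail-stable (ℕ.<⇒≤ (ℕ.≰⇒> j≰M)) j<2M+2))

sinhc-even : ∀ q → sinhc (2 ℕ.* q) ≡ oddRecip q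
sinhc-even zero    = refl
sinhc-even (suc q) = begin
  0ℚ + sinhTail (2 ℕ.* suc q) (2 ℕ.* suc q)
    ≡⟨ ℚ.+-identityˡ _ ⟩
  sinhTail (2 ℕ.* suc q) (2 ℕ.* suc q)
    ≡⟨ sinhTail-stable (ℕ.m≤n*m (suc q) 2) (ℕ.*-monoʳ-< 2 (ℕ.n<1+n (suc q))) ⟨
  sinhTail (suc q) (2 ℕ.* suc q)
    ≡⟨ Σ<-snoc q (λ i → oddRecip (suc i) * δ (2 ℕ.* suc i) (2 ℕ.* suc q)) ⟩
  sinhTail q (2 ℕ.* suc q) + oddRecip (suc q) * δ (2 ℕ.* suc q) (2 ℕ.* suc q)
    ≡⟨ cong₂ _+_ (sinhTail-> q (ℕ.*-monoʳ-< 2 (ℕ.n<1+n q)))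
                 (cong (oddRecip (suc q) *_) (δ-diagonal (2 ℕ.* suc q))) ⟩
  0ℚ + oddRecip (suc q) * 1ℚ
    ≡⟨ trans (ℚ.+-identityˡ _) (ℚ.*-identityʳ (oddRecip (suc q))) ⟩
  oddRecip (suc q) ∎

sinhc-odd : ∀ q → sinhc (suc (2 ℕ.* q)) ≡ 0ℚ
sinhc-odd q = begin
  0ℚ + sinhTail (suc (2 ℕ.* q)) (suc (2 ℕ.* q))
    ≡⟨ ℚ.+-identityˡ _ ⟩
  sinhTail (suc (2 ℕ.* q)) (suc (2 ℕ.* q))
    ≡⟨ sinhTail-stable (ℕ.m≤n⇒m≤1+n (ℕ.m≤n*m q 2)) 2q+1<2q+2 ⟨
  sinhTail q (suc (2 ℕ.* q))
    ≡⟨ sinhTail-> q (ℕ.n<1+n (2 ℕ.* q)) ⟩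
  0ℚ ∎
  where
  2q+1<2q+2 : suc (2 ℕ.* q) < 2 ℕ.* suc q
  2q+1<2q+2 = subst (suc (2 ℕ.* q) <_) (sym (ℕ.*-suc 2 q)) (ℕ.n<1+n (suc (2 ℕ.* q)))

even-or-odd : ∀ n → (Σ ℕ λ q → n ≡ 2 ℕ.* q) ⊎ (Σ ℕ λ q → n ≡ suc (2 ℕ.* q))
even-or-odd zero    = inj₁ (0 , refl)
even-or-odd (suc n) with even-or-odd n
... | inj₁ (q , n≡2q)   = inj₂ (q , cong suc n≡2q)
... | inj₂ (q , n≡2q+1) = inj₁ (suc q , trans (cong suc n≡2q+1) (sym (ℕ.*-suc 2 q)))

negOnePow-even : ∀ q → negOnePow (2 ℕ.* q) ≡ 1ℚ
negOnePow-even zero    = refl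
negOnePow-even (suc q) = trans (cong negOnePow (ℕ.*-suc 2 q))
  (trans (neg-involutive (negOnePow (2 ℕ.* q))) (negOnePow-even q))

two·zMul-sinhc : two · zMul sinhc ≈ twoSinh
two·zMul-sinhc zero = refl
two·zMul-sinhc (suc n) with even-or-odd n
... | inj₁ (q , refl) = begin
  two * (ℕ→ℚ (suc (2 ℕ.* q)) * sinhc (2 ℕ.* q))
    ≡⟨ cong (λ x → two * (ℕ→ℚ (suc (2 ℕ.* q)) * x)) (sinhc-even q) ⟩
  two * (ℕ→ℚ (suc (2 ℕ.* q)) * oddRecip q)
    ≡⟨ cong (two *_) (ℕ→ℚ-*-1/ (suc (2 ℕ.* q))) ⟩
  two * 1ℚ
    ≡⟨ cong (λ x → 1ℚ - - x) (negOnePow-even q) ⟨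
  1ℚ - - negOnePow (2 ℕ.* q) ∎
... | inj₂ (q , refl) = begin
  two * (ℕ→ℚ (suc (suc (2 ℕ.* q))) * sinhc (suc (2 ℕ.* q)))
    ≡⟨ cong (λ x → two * (ℕ→ℚ (suc (suc (2 ℕ.* q))) * x)) (sinhc-odd q) ⟩
  two * (ℕ→ℚ (suc (suc (2 ℕ.* q))) * 0ℚ)
    ≡⟨ trans (cong (two *_) (ℚ.*-zeroʳ (ℕ→ℚ (suc (suc (2 ℕ.* q)))))) (ℚ.*-zeroʳ two) ⟩
  0ℚ
    ≡⟨ ℚ.+-inverseʳ 1ℚ ⟨
  1ℚ - 1ℚ
    ≡⟨ cong (λ x → 1ℚ - x) (trans (cong negOnePow (sym (ℕ.*-suc 2 q))) (negOnePow-even (suc q))) ⟨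
  1ℚ - negOnePow (suc (suc (2 ℕ.* q))) ∎

sinhc⋆scaledBernoulli : sinhc ⋆ scaledBernoulli ≈ δ 0
sinhc⋆scaledBernoulli = zMul-injective λ n → ℕ→ℚ-suc-*-cancelˡ 1 (begin
  two * zMul (sinhc ⋆ scaledBernoulli) n      ≡⟨ cong (two *_) (zMul-⋆ sinhc scaledBernoulli n) ⟩
  two * (zMul sinhc ⋆ scaledBernoulli) n      ≡⟨ ·-⋆ two (zMul sinhc) scaledBernoulli n ⟨
  (two · zMul sinhc ⋆ scaledBernoulli) n      ≡⟨ ⋆-congʳ two·zMul-sinhc n ⟩
  (twoSinh ⋆ scaledBernoulli) n               ≡⟨ ⋆-comm twoSinh scaledBernoulli n ⟩
  (scaledBernoulli ⋆ twoSinh) n               ≡⟨ scaledBernoulli⋆twoSinh n ⟩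
  two * δ 1 n                                 ≡⟨ cong (two *_) (δ1≈zMul-δ0 n) ⟩
  two * zMul (δ 0) n                          ∎)
  where
  δ1≈zMul-δ0 : δ 1 ≈ zMul (δ 0)
  δ1≈zMul-δ0 zero          = refl
  δ1≈zMul-δ0 (suc zero)    = refl
  δ1≈zMul-δ0 (suc (suc k)) = sym (ℚ.*-zeroʳ (ℕ→ℚ (suc (suc k))))

multinomial-≡ : ∀ n rs → n ≡ sum rs → multinomial n rs ≡ (ℤ.+ (n !) / prodFact rs) {{prodFact≢0 rs}}
multinomial-≡ n rs n≡Σrs with n ≡ᵇ sum rs | ℕ.≡⇒≡ᵇ n (sum rs) n≡Σrs
... | true | _ = refl

multinomial-≢ : ∀ n rs → n ≢ sum rs → multinomial n rs ≡ 0ℚ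
multinomial-≢ n rs n≢Σrs with n ≡ᵇ sum rs in eq
... | false = refl
... | true  = ⊥-elim (n≢Σrs (ℕ.≡ᵇ⇒≡ n (sum rs) (subst T (sym eq) _)))

n!/[k!*P]≡C*[n∸k]!/P : ∀ n k P .{{_ : ℕ.NonZero P}} → k ≤ n →
  (ℤ.+ (n !) / (k ! ℕ.* P)) {{ℕ.m*n≢0 (k !) P {{k ℕ.!≢0}}}} ≡ ℕ→ℚ (n C k) * (ℤ.+ ((n ∸ k) !) / P)
n!/[k!*P]≡C*[n∸k]!/P n k P k≤n = begin
  (ℤ.+ (n !) / (k ! ℕ.* P)) {{k!*P≢0}}
    ≡⟨ /-as-* (n !) (k ! ℕ.* P) {{k!*P≢0}} ⟩
  ℕ→ℚ (n !) * (ℤ.+ 1 / (k ! ℕ.* P)) {{k!*P≢0}}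
    ≡⟨ cong₂ _*_ (cong ℕ→ℚ (sym C*k!*[n∸k]!≡n!)) (1/-* (k !) P {{k ℕ.!≢0}}) ⟩
  ℕ→ℚ ((n C k) ℕ.* (k ! ℕ.* (n ∸ k) !)) * (1/k! * 1/P)
    ≡⟨ cong (_* (1/k! * 1/P)) (trans (ℕ→ℚ-* (n C k) _) (cong (c *_) (ℕ→ℚ-* (k !) ((n ∸ k) !)))) ⟩
  c * (k! * f) * (1/k! * 1/P)
    ≡⟨ regroup c k! f 1/k! 1/P ⟩
  c * ((k! * 1/k!) * (f * 1/P))
    ≡⟨ cong (λ x → c * (x * (f * 1/P))) (ℕ→ℚ-*-1/ (k !) {{k ℕ.!≢0}}) ⟩
  c * (1ℚ * (f * 1/P))
    ≡⟨ cong (c *_) (trans (ℚ.*-identityˡ (f * 1/P)) (sym (/-as-* ((n ∸ k) !) P))) ⟩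
  c * (ℤ.+ ((n ∸ k) !) / P) ∎
  where
  k!*P≢0 = ℕ.m*n≢0 (k !) P {{k ℕ.!≢0}}
  c = ℕ→ℚ (n C k)
  k! = ℕ→ℚ (k !)
  f = ℕ→ℚ ((n ∸ k) !)
  1/k! = (ℤ.+ 1 / k !) {{k ℕ.!≢0}}
  1/P = ℤ.+ 1 / P
  C*k!*[n∸k]!≡n! : (n C k) ℕ.* (k ! ℕ.* (n ∸ k) !) ≡ n !
  C*k!*[n∸k]!≡n! = trans (cong (ℕ._* (k ! ℕ.* (n ∸ k) !)) (ℕ.nCk≡n!/k![n-k]! k≤n))
    (ℕ.m/n*n≡m {{ℕ.m*n≢0 (k !) ((n ∸ k) !) {{k ℕ.!≢0}} {{(n ∸ k) ℕ.!≢0}}}} (ℕ.k![n∸k]!∣n! k≤n))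
  regroup : ∀ c a f ia iP → c * (a * f) * (ia * iP) ≡ c * ((a * ia) * (f * iP))
  regroup = solve 5 (λ c a f ia iP → c :* (a :* f) :* (ia :* iP) := c :* ((a :* ia) :* (f :* iP))) refl

multinomial-∷ : ∀ n k rs → multinomial n (k ∷ rs) ≡ ℕ→ℚ (n C k) * multinomial (n ∸ k) rs
multinomial-∷ n k rs with k ℕ.≤? n
... | no k≰n = begin
  multinomial n (k ∷ rs)
    ≡⟨ multinomial-≢ n (k ∷ rs) (λ n≡ → k≰n (subst (k ≤_) (sym n≡) (ℕ.m≤m+n k (sum rs)))) ⟩
  0ℚ
    ≡⟨ ℚ.*-zeroˡ (multinomial (n ∸ k) rs) ⟨
  0ℚ * multinomial (n ∸ k) rs
    ≡⟨ cong (λ c → ℕ→ℚ c * multinomial (n ∸ k) rs) (ℕ.k>n⇒nCk≡0 (ℕ.≰⇒> k≰n)) ⟨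
  ℕ→ℚ (n C k) * multinomial (n ∸ k) rs ∎
... | yes k≤n with (n ∸ k) ℕ.≟ sum rs
...   | yes n∸k≡Σrs = begin
  multinomial n (k ∷ rs)
    ≡⟨ multinomial-≡ n (k ∷ rs) (trans (sym (ℕ.m+[n∸m]≡n k≤n)) (cong (k ℕ.+_) n∸k≡Σrs)) ⟩
  (ℤ.+ (n !) / (k ! ℕ.* prodFact rs)) {{prodFact≢0 (k ∷ rs)}}
    ≡⟨ n!/[k!*P]≡C*[n∸k]!/P n k (prodFact rs) {{prodFact≢0 rs}} k≤n ⟩
  ℕ→ℚ (n C k) * (ℤ.+ ((n ∸ k) !) / prodFact rs) {{prodFact≢0 rs}}
    ≡⟨ cong (ℕ→ℚ (n C k) *_) (multinomial-≡ (n ∸ k) rs n∸k≡Σrs) ⟨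
  ℕ→ℚ (n C k) * multinomial (n ∸ k) rs ∎
...   | no  n∸k≢Σrs = begin
  multinomial n (k ∷ rs)
    ≡⟨ multinomial-≢ n (k ∷ rs) (λ n≡ → n∸k≢Σrs (trans (cong (_∸ k) n≡) (ℕ.m+n∸m≡n k (sum rs)))) ⟩
  0ℚ
    ≡⟨ ℚ.*-zeroʳ (ℕ→ℚ (n C k)) ⟨
  ℕ→ℚ (n C k) * 0ℚ
    ≡⟨ cong (ℕ→ℚ (n C k) *_) (multinomial-≢ (n ∸ k) rs n∸k≢Σrs) ⟨
  ℕ→ℚ (n C k) * multinomial (n ∸ k) rs ∎

-- The inner sums of the right-hand side are the coefficients of the powers of T

infixr 9 _^⋆_

_^⋆_ : Seq → ℕ → Seq
f ^⋆ zero  = δ 0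
f ^⋆ suc K = f ⋆ f ^⋆ K

tupleTerm : ℕ → List ℕ → ℚ
tupleTerm n qs = (ℤ.+ 1 / prodOdd qs) {{prodOdd≢0 qs}} * multinomial n (map (2 ℕ.*_) qs)

tupleSum : ℕ → ℕ → Seq
tupleSum m K n = sumℚ (map (tupleTerm n) (tuples m K))

tupleTerm-∷ : ∀ q qs n → tupleTerm n (q ∷ qs) ≡ (oddRecip q · δ (2 ℕ.* q) ⋆ λ m → tupleTerm m qs) n
tupleTerm-∷ q qs n = begin
  w (q ∷ qs) * multinomial n (2 ℕ.* q ∷ map (2 ℕ.*_) qs)
    ≡⟨ cong₂ _*_ (1/-* (suc (2 ℕ.* q)) (prodOdd qs) {{_}} {{prodOdd≢0 qs}})
                 (multinomial-∷ n (2 ℕ.* q) (map (2 ℕ.*_) qs)) ⟩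
  (oddRecip q * w qs) * (ℕ→ℚ (n C (2 ℕ.* q)) * multinomial (n ∸ 2 ℕ.* q) (map (2 ℕ.*_) qs))
    ≡⟨ regroup (oddRecip q) (w qs) (ℕ→ℚ (n C (2 ℕ.* q))) _ ⟩
  oddRecip q * (ℕ→ℚ (n C (2 ℕ.* q)) * tupleTerm (n ∸ 2 ℕ.* q) qs)
    ≡⟨ cong (oddRecip q *_) (δ-⋆ (2 ℕ.* q) (λ m → tupleTerm m qs) n) ⟨
  oddRecip q * (δ (2 ℕ.* q) ⋆ (λ m → tupleTerm m qs)) n
    ≡⟨ ·-⋆ (oddRecip q) (δ (2 ℕ.* q)) (λ m → tupleTerm m qs) n ⟨
  (oddRecip q · δ (2 ℕ.* q) ⋆ (λ m → tupleTerm m qs)) n ∎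
  where
  w : List ℕ → ℚ
  w qs = (ℤ.+ 1 / prodOdd qs) {{prodOdd≢0 qs}}
  regroup : ∀ a b c d → (a * b) * (c * d) ≡ a * (c * (b * d))
  regroup = solve 4 (λ a b c d → (a :* b) :* (c :* d) := a :* (c :* (b :* d))) refl

tupleSum-suc : ∀ m K → tupleSum m (suc K) ≈ sinhTail m ⋆ tupleSum m K
tupleSum-suc m K n = begin
  sumℚ (map (tupleTerm n) (concatMap (λ q → map (q ∷_) (tuples m K)) qs))
    ≡⟨ sumℚ-concatMap (tupleTerm n) (λ q → map (q ∷_) (tuples m K)) qs ⟩
  sumℚ (map (λ q → sumℚ (map (tupleTerm n) (map (q ∷_) (tuples m K)))) qs)
    ≡⟨ cong sumℚ (List.map-cong (λ q → cong sumℚ (trans (sym (List.map-∘ (tuples m K)))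
                                                 (List.map-cong (λ qs → tupleTerm-∷ q qs n) (tuples m K))))
                                 qs) ⟩
  sumℚ (map (λ q → sumℚ (map (λ qs → (oddRecip q · δ (2 ℕ.* q) ⋆ λ j → tupleTerm j qs) n) (tuples m K))) qs)
    ≡⟨ cong sumℚ (List.map-cong (λ q →
         ⋆-sumʳ (tuples m K) (oddRecip q · δ (2 ℕ.* q)) (λ qs j → tupleTerm j qs) n) qs) ⟨
  sumℚ (map (λ q → (oddRecip q · δ (2 ℕ.* q) ⋆ tupleSum m K) n) qs)
    ≡⟨ ⋆-sumˡ qs (λ q → oddRecip q · δ (2 ℕ.* q)) (tupleSum m K) n ⟨
  ((λ j → sumℚ (map (λ q → oddRecip q * δ (2 ℕ.* q) j) qs)) ⋆ tupleSum m K) n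
    ≡⟨ ⋆-congʳ (λ j → trans (cong sumℚ (sym (List.map-∘ (upTo m))))
                            (sumℚ-map-upTo m (λ i → oddRecip (suc i) * δ (2 ℕ.* suc i) j))) n ⟩
  (sinhTail m ⋆ tupleSum m K) n ∎
  where qs = map suc (upTo m)

tupleSum≈^⋆ : ∀ m K → tupleSum m K ≈ sinhTail m ^⋆ K
tupleSum≈^⋆ m zero    zero    = refl
tupleSum≈^⋆ m zero    (suc n) = refl
tupleSum≈^⋆ m (suc K) n       = trans (tupleSum-suc m K n) (⋆-congˡ (tupleSum≈^⋆ m K) n)

VanishesBelow : ℕ → Seq → Set
VanishesBelow a f = ∀ {j} → j < a → f j ≡ 0ℚ

∂-vanishesBelow : ∀ {a f} → VanishesBelow a f → VanishesBelow (ℕ.pred a) (∂ f)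
∂-vanishesBelow {zero}  _  ()
∂-vanishesBelow {suc a} f0 j<a = f0 (s≤s j<a)

⋆-vanishesBelow : ∀ {a c f g} → VanishesBelow a f → VanishesBelow c g → VanishesBelow (a ℕ.+ c) (f ⋆ g)
⋆-vanishesBelow {suc a} {c} {f} {g} f0 g0 {zero} _ = trans (cong (_* g 0) (f0 (s≤s z≤n))) (ℚ.*-zeroˡ (g 0))
⋆-vanishesBelow {zero} {suc c} {f} {g} f0 g0 {zero} _ = trans (cong (f 0 *_) (g0 (s≤s z≤n))) (ℚ.*-zeroʳ (f 0))
⋆-vanishesBelow {a} {c} f0 g0 {suc n} n+1<a+c = trans
  (cong₂ _+_ (⋆-vanishesBelow (∂-vanishesBelow f0) g0 (<-pred-+ˡ a n+1<a+c))
             (⋆-vanishesBelow f0 (∂-vanishesBelow g0) (<-pred-+ʳ a n+1<a+c)))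
  (ℚ.+-identityˡ 0ℚ)
  where
  <-pred-+ˡ : ∀ a {c} → suc n < a ℕ.+ c → n < ℕ.pred a ℕ.+ c
  <-pred-+ˡ zero    lt = ℕ.<-trans (ℕ.n<1+n n) lt
  <-pred-+ˡ (suc a) lt = ℕ.≤-pred lt
  <-pred-+ʳ : ∀ a {c} → suc n < a ℕ.+ c → n < a ℕ.+ ℕ.pred c
  <-pred-+ʳ a {c} lt = subst (n <_) (ℕ.+-comm (ℕ.pred c) a) (<-pred-+ˡ c (subst (suc n <_) (ℕ.+-comm a c) lt))

^⋆-vanishesBelow : ∀ {a f} → VanishesBelow a f → ∀ K → VanishesBelow (K ℕ.* a) (f ^⋆ K)
^⋆-vanishesBelow f0 zero    ()
^⋆-vanishesBelow f0 (suc K) = ⋆-vanishesBelow f0 (^⋆-vanishesBelow f0 K)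

^⋆-cong-< : ∀ {b f g} → (∀ {j} → j < b → f j ≡ g j) → ∀ K {j} → j < b → (f ^⋆ K) j ≡ (g ^⋆ K) j
^⋆-cong-< f≡g zero    _   = refl
^⋆-cong-< f≡g (suc K) {j} j<b = ⋆-cong-≤ j
  (λ k k≤j → f≡g (ℕ.≤-<-trans k≤j j<b)) (λ k k≤j → ^⋆-cong-< f≡g K (ℕ.≤-<-trans k≤j j<b))

-- S ⋆ (Σ_{K ≤ N} (-1)ᴷ Tᴷ) telescopes to 1 - (-1)ᴺ⁺¹ T^{N+1}, whose second term starts in degree 2N + 2

altPowSum : ℕ → Seq
altPowSum N n = Σ< (suc N) (λ K → negOnePow K * (sinhTail N ^⋆ K) n)

n<[1+n/2]*2 : ∀ n → n < suc (n ℕ./ 2) ℕ.* 2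
n<[1+n/2]*2 n = subst (_< 2 ℕ.+ (n ℕ./ 2) ℕ.* 2) (sym (ℕ.m≡m%n+[m/n]*n n 2))
  (ℕ.+-monoˡ-< ((n ℕ./ 2) ℕ.* 2) (ℕ.m%n<n n 2))

rhsSum≡altPowSum : ∀ {N n} → n ≤ N → rhsSum n ≡ altPowSum N n
rhsSum≡altPowSum {N} {n} n≤N = begin
  rhsSum n
    ≡⟨ sumℚ-map-upTo (suc h) (λ K → negOnePow K * tupleSum h K n) ⟩
  Σ< (suc h) (λ K → negOnePow K * tupleSum h K n)
    ≡⟨ Σ<-cong (suc h) (λ K _ → cong (negOnePow K *_) (trans (tupleSum≈^⋆ h K n)
         (^⋆-cong-< (sinhTail-stable h≤N) K n<2[1+h]))) ⟩
  Σ< (suc h) (λ K → negOnePow K * (sinhTail N ^⋆ K) n)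
    ≡⟨ Σ<-extend (λ K → negOnePow K * (sinhTail N ^⋆ K) n) (s≤s h≤N) (λ K 1+h≤K →
         trans (cong (negOnePow K *_) (^⋆-vanishesBelow (sinhTail-vanishesBelow2 N) K
                                         (ℕ.<-≤-trans (n<[1+n/2]*2 n) (ℕ.*-monoˡ-≤ 2 1+h≤K))))
               (ℚ.*-zeroʳ (negOnePow K))) ⟩
  altPowSum N n ∎
  where
  h = n ℕ./ 2
  h≤N = ℕ.≤-trans (ℕ.m/n≤m n 2) n≤N
  n<2[1+h] = subst (n <_) (ℕ.*-comm (suc h) 2) (n<[1+n/2]*2 n)

Σ<-alternating-telescope : ∀ L (c a : ℕ → ℚ) → (∀ K → c (suc K) ≡ - c K) →
  Σ< L (λ K → c K * a K) + Σ< L (λ K → c K * a (suc K)) ≡ c 0 * a 0 - c L * a L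
Σ<-alternating-telescope zero    c a _  = trans (ℚ.+-identityˡ 0ℚ) (sym (ℚ.+-inverseʳ (c 0 * a 0)))
Σ<-alternating-telescope (suc L) c a c- = begin
  (c 0 * a 0 + A) + (c 0 * a 1 + B)
    ≡⟨ interchange (c 0 * a 0) A (c 0 * a 1) B ⟩
  (c 0 * a 0 + c 0 * a 1) + (A + B)
    ≡⟨ cong ((c 0 * a 0 + c 0 * a 1) +_)
         (Σ<-alternating-telescope L (λ K → c (suc K)) (λ K → a (suc K)) (λ K → c- (suc K))) ⟩
  (c 0 * a 0 + c 0 * a 1) + (c 1 * a 1 - c (suc L) * a (suc L))
    ≡⟨ cong (λ x → (c 0 * a 0 + c 0 * a 1) + (x * a 1 - c (suc L) * a (suc L))) (c- 0) ⟩
  (c 0 * a 0 + c 0 * a 1) + ((- c 0) * a 1 - c (suc L) * a (suc L))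
    ≡⟨ cancel (c 0 * a 0) (c 0) (a 1) (c (suc L) * a (suc L)) ⟩
  c 0 * a 0 - c (suc L) * a (suc L) ∎
  where
  A = Σ< L (λ K → c (suc K) * a (suc K))
  B = Σ< L (λ K → c (suc K) * a (suc (suc K)))
  interchange : ∀ x A y B → (x + A) + (y + B) ≡ (x + y) + (A + B)
  interchange = solve 4 (λ x A y B → (x :+ A) :+ (y :+ B) := (x :+ y) :+ (A :+ B)) refl
  cancel : ∀ x c a z → (x + c * a) + ((- c) * a - z) ≡ x - z
  cancel = solve 4 (λ x c a z → (x :+ c :* a) :+ ((:- c) :* a :- z) := x :- z) refl

sinhc⋆rhsSum : sinhc ⋆ rhsSum ≈ δ 0
sinhc⋆rhsSum N = begin
  (sinhc ⋆ rhsSum) N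
    ≡⟨ ⋆-cong-≤ N (λ k k≤N → sinhc-stable N (ℕ.<-≤-trans (s≤s k≤N) (ℕ.m≤n*m (suc N) 2)))
                  (λ k k≤N → rhsSum≡altPowSum k≤N) ⟩
  ((δ 0 ⊕ 𝕋) ⋆ altPowSum N) N
    ≡⟨ ⋆-distribʳ-⊕ (δ 0) 𝕋 (altPowSum N) N ⟩
  (δ 0 ⋆ altPowSum N) N + (𝕋 ⋆ altPowSum N) N
    ≡⟨ cong₂ _+_ (⋆-identityˡ (altPowSum N) N)
         (trans (⋆-Σ<ʳ (suc N) 𝕋 (λ K m → negOnePow K * (𝕋 ^⋆ K) m) N)
                (Σ<-cong (suc N) (λ K _ → ⋆-· (negOnePow K) 𝕋 (𝕋 ^⋆ K) N))) ⟩
  altPowSum N N + Σ< (suc N) (λ K → negOnePow K * (𝕋 ^⋆ suc K) N)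
    ≡⟨ Σ<-alternating-telescope (suc N) negOnePow (λ K → (𝕋 ^⋆ K) N) (λ K → refl) ⟩
  1ℚ * δ 0 N - negOnePow (suc N) * (𝕋 ^⋆ suc N) N
    ≡⟨ cong (λ x → 1ℚ * δ 0 N - negOnePow (suc N) * x)
         (^⋆-vanishesBelow (sinhTail-vanishesBelow2 N) (suc N) (ℕ.<-≤-trans (ℕ.n<1+n N) (ℕ.m≤m*n (suc N) 2))) ⟩
  1ℚ * δ 0 N - negOnePow (suc N) * 0ℚ
    ≡⟨ cong₂ _-_ (ℚ.*-identityˡ (δ 0 N)) (ℚ.*-zeroʳ (negOnePow (suc N))) ⟩
  δ 0 N - 0ℚ
    ≡⟨ ℚ.+-identityʳ (δ 0 N) ⟩
  δ 0 N ∎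
  where 𝕋 = sinhTail N

-- The hypothesis n ≢ 1 is implied by the instance, as denom 1 = 0.
mainTheorem11 : (n : ℕ) → n ≢ 1 → .{{_ : NonZero (denom n)}} →
    bernoulli n ≡ (1/ denom n) * rhsSum n
mainTheorem11 n _ = sym (begin
  (1/ denom n) * rhsSum n
    ≡⟨ cong ((1/ denom n) *_) (⋆-inverse-unique sinhc⋆rhsSum sinhc⋆scaledBernoulli n) ⟩
  (1/ denom n) * (denom n * bernoulli n) ≡⟨ ℚ.*-assoc (1/ denom n) (denom n) (bernoulli n) ⟨
  ((1/ denom n) * denom n) * bernoulli n ≡⟨ cong (_* bernoulli n) (ℚ.*-inverseˡ (denom n)) ⟩
  1ℚ * bernoulli n                       ≡⟨ ℚ.*-identityˡ (bernoulli n) ⟩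
  bernoulli n                            ∎)
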